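{- Let $\mathcal{P}$ be a palette with density $d(\mathcal{P})>4/81$. Then there exists a homomorphism from $\mathcal{P}_{\rm LM}$ to $\mathcal{P}$ or to $\mathrm{inv}(\mathcal{P})$, or there exists a homomorphism from $\mathcal{P}_{\rm 3T}$ to $\mathcal{P}$.
   Context: A palette $\mathcal{P}=(C,T)$ consists of a finite nonempty set $C$ of colors and a set $T\subseteq C^3$ of feasible triples; its density is $d(\mathcal{P})=|T|/|C|^3$. The inverse palette $\mathrm{inv}(\mathcal{P})=(C,T')$ has $(x,y,z)\in T'$ iff $(z,y,x)\in T$. A homomorphism from $(C,T)$ to $(C',T')$ is a map $f:C\to C'$ with $(f(x),f(y),f(z))\in T'$ for all $(x,y,z)\in T$. $\mathcal{P}_{\rm LM}$ is the palette with colors $\{\alpha,\beta',\gamma,\gamma',\omega\}$ (five distinct colors) and feasible triples $(\alpha,\omega,\gamma)$ and $(\omega,\beta',\gamma')$. $\mathcal{P}_{\rm 3T}$ is the palette with colors $\{\alpha,\beta,\beta',\beta'',\gamma'',\omega,\omega'\}$ (seven distinct colors) and feasible triples $(\alpha,\beta,\omega)$, $(\omega,\beta',\omega')$ and $(\omega',\beta'',\gamma'')$. -}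

module Defs where

open import Data.Nat using (ℕ; suc; _+_; _*_; _<_)
open import Data.Fin using (Fin)
open import Data.Bool using (Bool; true; false; if_then_else_)
open import Data.List using (map; allFin)
open import Data.Nat.ListAction using (sum)
open import Relation.Binary.PropositionalEquality using (_≡_)

record Palette : Set where
  constructor palette
  field
    k        : ℕ                               -- number of colors is suc k
    feasible : Fin (suc k) → Fin (suc k) → Fin (suc k) → Bool

open Palette public

Color : Palette → Set
Color P = Fin (suc (k P))

ncolors : Palette → ℕ
ncolors P = suc (k P)

Feasible : (P : Palette) → Color P → Color P → Color P → Set
Feasible P x y z = feasible P x y z ≡ true

numTriples : Palette → ℕ
numTriples P =
  sum (map (λ x → sum (map (λ y → sum (map (λ z → if feasible P x y z then 1 else 0)
        (allFin (ncolors P)))) (allFin (ncolors P)))) (allFin (ncolors P)))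

-- d(P) > 4/81  ⇔  |T| / |C|^3 > 4/81  ⇔  4·|C|^3 < 81·|T|
DensityAbove4/81 : Palette → Set
DensityAbove4/81 P = 4 * (ncolors P * ncolors P * ncolors P) < 81 * numTriples P

inv : Palette → Palette
inv P = palette (k P) (λ x y z → feasible P z y x)

-- P_LM: colors α, β', γ, γ', ω (five distinct colors), feasible triples
-- (α,ω,γ) and (ω,β',γ').  A homomorphism from P_LM to P is a map f of the
-- five colors into Color P sending both feasible triples to feasible triples.
record HomLM (P : Palette) : Set where
  field
    α β′ γ γ′ ω : Color P
    t₁ : Feasible P α ω γ
    t₂ : Feasible P ω β′ γ′

-- P_3T: colors α, β, β', β'', γ'', ω, ω' (seven distinct colors), feasible
-- triples (α,β,ω), (ω,β',ω'), (ω',β'',γ'').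
record Hom3T (P : Palette) : Set where
  field
    α β β′ β″ γ″ ω ω′ : Color P
    t₁ : Feasible P α β ω
    t₂ : Feasible P ω β′ ω′
    t₃ : Feasible P ω′ β″ γ″

-- Suppose P admits none of the three homomorphisms.  A colour occurring in the middle
-- of a feasible triple then occurs neither first (that gives P_LM → P) nor last
-- (P_LM → inv P) in any feasible triple, and in a feasible triple (x, y, z) the colour x
-- cannot also occur last while z also occurs first (P_3T → P).  So, if m colours occur
-- in the middle and, of the others, a occur only first, b both first and last and
-- c only last, every feasible triple has a middle colour in the middle and its ends in
-- one of the classes (a, b), (a, c), (b, c).  Hence, with s = a + b + c and m + s ≤ |C|,
-- |T| ≤ m (ab + ac + bc) ≤ m s² / 3 ≤ 4 (m + s)³ / 81, the last step by AM-GM for m, s/2, s/2.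
module Submission where

open import Defs
open import Data.Nat
open import Data.Nat.Properties
open import Data.Nat.ListAction using (sum)
open import Data.Nat.Tactic.RingSolver using (solve)
open import Algebra.Properties.CommutativeSemigroup +-commutativeSemigroup using (interchange)
open import Data.List using (List; []; _∷_; map; allFin; length)
open import Data.List.Properties using (length-tabulate)
open import Data.Fin.Properties using (any?)
open import Data.Bool using (true; false; if_then_else_)
import Data.Bool.Properties as Bool
open import Data.Product using (∃; _×_; _,_)
open import Data.Sum using (_⊎_; inj₁; inj₂)
open import Data.Empty using (⊥-elim)
open import Relation.Nullary using (¬_; Dec; yes; no)
open import Relation.Nullary.Decidable using (map′; _×-dec_)
open import Relation.Binary.PropositionalEquality
  using (_≡_; refl; sym; trans; cong; cong₂; module ≡-Reasoning)

module _ {A : Set} where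

  sumOver : List A → (A → ℕ) → ℕ
  sumOver xs f = sum (map f xs)

  sumOver-mono-≤ : ∀ {f g} xs → (∀ x → f x ≤ g x) → sumOver xs f ≤ sumOver xs g
  sumOver-mono-≤ []       f≤g = z≤n
  sumOver-mono-≤ (x ∷ xs) f≤g = +-mono-≤ (f≤g x) (sumOver-mono-≤ xs f≤g)

  sumOver-cong : ∀ {f g} xs → (∀ x → f x ≡ g x) → sumOver xs f ≡ sumOver xs g
  sumOver-cong []       f≡g = refl
  sumOver-cong (x ∷ xs) f≡g = cong₂ _+_ (f≡g x) (sumOver-cong xs f≡g)

  sumOver-+ : ∀ f g xs → sumOver xs (λ x → f x + g x) ≡ sumOver xs f + sumOver xs g
  sumOver-+ f g []       = refl
  sumOver-+ f g (x ∷ xs) =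
    trans (cong (f x + g x +_) (sumOver-+ f g xs))
          (interchange (f x) (g x) (sumOver xs f) (sumOver xs g))

  sumOver-*ˡ : ∀ c f xs → sumOver xs (λ x → c * f x) ≡ c * sumOver xs f
  sumOver-*ˡ c f []       = sym (*-zeroʳ c)
  sumOver-*ˡ c f (x ∷ xs) =
    trans (cong (c * f x +_) (sumOver-*ˡ c f xs)) (sym (*-distribˡ-+ c (f x) (sumOver xs f)))

  sumOver-*ʳ : ∀ c f xs → sumOver xs (λ x → f x * c) ≡ sumOver xs f * c
  sumOver-*ʳ c f []       = refl
  sumOver-*ʳ c f (x ∷ xs) =
    trans (cong (f x * c +_) (sumOver-*ʳ c f xs)) (sym (*-distribʳ-+ c (f x) (sumOver xs f)))

  sumOver-1 : ∀ xs → sumOver xs (λ _ → 1) ≡ length xs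
  sumOver-1 []       = refl
  sumOver-1 (x ∷ xs) = cong suc (sumOver-1 xs)

  sumOver²-+ : ∀ (f g : A → A → ℕ) xs ys →
    sumOver xs (λ x → sumOver ys (λ y → f x y + g x y)) ≡
    sumOver xs (λ x → sumOver ys (f x)) + sumOver xs (λ x → sumOver ys (g x))
  sumOver²-+ f g xs ys =
    trans (sumOver-cong xs (λ x → sumOver-+ (f x) (g x) ys)) (sumOver-+ _ _ xs)

  sumOver²-* : ∀ (f g : A → ℕ) xs ys →
    sumOver xs (λ x → sumOver ys (λ y → f x * g y)) ≡ sumOver xs f * sumOver ys g
  sumOver²-* f g xs ys =
    trans (sumOver-cong xs (λ x → sumOver-*ˡ (f x) g ys)) (sumOver-*ʳ (sumOver ys g) f xs)

data Role : Set where
  middle first inner last unused : Role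

classify : ∀ {M F L : Set} → Dec M → Dec F → Dec L → Role
classify (yes _) _       _       = middle
classify (no _)  (yes _) (yes _) = inner
classify (no _)  (yes _) (no _)  = first
classify (no _)  (no _)  (yes _) = last
classify (no _)  (no _)  (no _)  = unused

δ : Role → Role → ℕ
δ middle middle = 1
δ first  first  = 1
δ inner  inner  = 1
δ last   last   = 1
δ unused unused = 1
δ _      _      = 0

δ-partition : ∀ u → δ middle u + (δ first u + δ inner u + δ last u) ≤ 1
δ-partition middle = ≤-refl
δ-partition first  = ≤-refl
δ-partition inner  = ≤-refl
δ-partition last   = ≤-refl
δ-partition unused = z≤n

data Allowed : Role → Role → Role → Set where
  first-inner : Allowed first middle inner
  first-last  : Allowed first middle last
  inner-last  : Allowed inner middle last

endWeight : Role → Role → ℕ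
endWeight u w = δ first u * δ inner w + δ first u * δ last w + δ inner u * δ last w

allowed⇒1≤weight : ∀ {u v w} → Allowed u v w → 1 ≤ δ middle v * endWeight u w
allowed⇒1≤weight first-inner = ≤-refl
allowed⇒1≤weight first-last  = ≤-refl
allowed⇒1≤weight inner-last  = ≤-refl

indicator≤ : ∀ b {k} → (b ≡ true → 1 ≤ k) → (if b then 1 else 0) ≤ k
indicator≤ false _   = z≤n
indicator≤ true  1≤k = 1≤k refl

module Counting (P : Palette) (role : Color P → Role) where

  colors : List (Color P)
  colors = allFin (ncolors P)

  is : Role → Color P → ℕ
  is r c = δ r (role c)

  #_ : Role → ℕ
  # r = sumOver colors (is r)

  endPairs : sumOver colors (λ x → sumOver colors (λ z → endWeight (role x) (role z)))
           ≡ # first * # inner + # first * # last + # inner * # last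
  endPairs = begin
    ΣΣ (λ x z → p x z + q x z + r x z)  ≡⟨ sumOver²-+ (λ x z → p x z + q x z) r colors colors ⟩
    ΣΣ (λ x z → p x z + q x z) + ΣΣ r   ≡⟨ cong (_+ ΣΣ r) (sumOver²-+ p q colors colors) ⟩
    ΣΣ p + ΣΣ q + ΣΣ r                  ≡⟨ cong₂ _+_ (cong₂ _+_ (outer first inner) (outer first last))
                                                     (outer inner last) ⟩
    # first * # inner + # first * # last + # inner * # last ∎
    where
    open ≡-Reasoning
    ΣΣ : (Color P → Color P → ℕ) → ℕ
    ΣΣ f = sumOver colors (λ x → sumOver colors (f x))
    outer : ∀ s t → ΣΣ (λ x z → is s x * is t z) ≡ # s * # t
    outer s t = sumOver²-* (is s) (is t) colors colors
    p q r : Color P → Color P → ℕ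
    p x z = is first x * is inner z
    q x z = is first x * is last z
    r x z = is inner x * is last z

  numTriples≤ : (∀ {x y z} → Feasible P x y z → Allowed (role x) (role y) (role z)) →
    numTriples P ≤ # middle * (# first * # inner + # first * # last + # inner * # last)
  numTriples≤ allowed = begin
    numTriples P
      ≤⟨ sumOver-mono-≤ colors (λ x → sumOver-mono-≤ colors (λ y → sumOver-mono-≤ colors (λ z →
           indicator≤ (feasible P x y z) (λ t → allowed⇒1≤weight (allowed t))))) ⟩
    sumOver colors (λ x → sumOver colors (λ y → sumOver colors (λ z → is middle y * W x z)))
      ≡⟨ sumOver-cong colors (λ x → sumOver-cong colors (λ y → sumOver-*ˡ (is middle y) (W x) colors)) ⟩
    sumOver colors (λ x → sumOver colors (λ y → is middle y * sumOver colors (W x)))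
      ≡⟨ sumOver-cong colors (λ x → sumOver-*ʳ (sumOver colors (W x)) (is middle) colors) ⟩
    sumOver colors (λ x → # middle * sumOver colors (W x))
      ≡⟨ sumOver-*ˡ (# middle) (λ x → sumOver colors (W x)) colors ⟩
    # middle * sumOver colors (λ x → sumOver colors (W x))
      ≡⟨ cong (# middle *_) endPairs ⟩
    # middle * (# first * # inner + # first * # last + # inner * # last) ∎
    where
    open ≤-Reasoning
    W : Color P → Color P → ℕ
    W x z = endWeight (role x) (role z)

  roles≤ncolors : # middle + (# first + # inner + # last) ≤ ncolors P
  roles≤ncolors = begin
    # middle + (# first + # inner + # last)
      ≡⟨ sumOver-split ⟨
    sumOver colors (λ c → is middle c + (is first c + is inner c + is last c))
      ≤⟨ sumOver-mono-≤ colors (λ c → δ-partition (role c)) ⟩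
    sumOver colors (λ _ → 1)
      ≡⟨ sumOver-1 colors ⟩
    length colors
      ≡⟨ length-tabulate {n = ncolors P} (λ c → c) ⟩
    ncolors P ∎
    where
    open ≤-Reasoning
    sumOver-split : sumOver colors (λ c → is middle c + (is first c + is inner c + is last c))
                  ≡ # middle + (# first + # inner + # last)
    sumOver-split = begin-equality
      sumOver colors (λ c → is middle c + (is first c + is inner c + is last c))
        ≡⟨ sumOver-+ (is middle) (λ c → is first c + is inner c + is last c) colors ⟩
      # middle + sumOver colors (λ c → is first c + is inner c + is last c)
        ≡⟨ cong (# middle +_) (sumOver-+ (λ c → is first c + is inner c) (is last) colors) ⟩
      # middle + (sumOver colors (λ c → is first c + is inner c) + # last)
        ≡⟨ cong (λ t → # middle + (t + # last)) (sumOver-+ (is first) (is inner) colors) ⟩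
      # middle + (# first + # inner + # last) ∎

module Positions (P : Palette) where

  IsMiddle IsFirst IsLast : Color P → Set
  IsMiddle y = ∃ λ x → ∃ λ z → Feasible P x y z
  IsFirst  x = ∃ λ y → ∃ λ z → Feasible P x y z
  IsLast   z = ∃ λ x → ∃ λ y → Feasible P x y z

  feasible? : ∀ x y z → Dec (Feasible P x y z)
  feasible? x y z = feasible P x y z Bool.≟ true

  middle? : ∀ y → Dec (IsMiddle y)
  middle? y = any? λ x → any? λ z → feasible? x y z

  first? : ∀ x → Dec (IsFirst x)
  first? x = any? λ y → any? λ z → feasible? x y z

  last? : ∀ z → Dec (IsLast z)
  last? z = any? λ x → any? λ y → feasible? x y z

  role : Color P → Role
  role c = classify (middle? c) (first? c) (last? c)

  role-middle : ∀ {c} → IsMiddle c → role c ≡ middle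
  role-middle {c} m with middle? c
  ... | yes _ = refl
  ... | no ¬m = ⊥-elim (¬m m)

  role-first : ∀ {c} → ¬ IsMiddle c → IsFirst c → role c ≡ first ⊎ (role c ≡ inner × IsLast c)
  role-first {c} ¬m f with middle? c | first? c | last? c
  ... | yes m | _      | _     = ⊥-elim (¬m m)
  ... | no _  | no ¬f  | _     = ⊥-elim (¬f f)
  ... | no _  | yes _  | yes l = inj₂ (refl , l)
  ... | no _  | yes _  | no _  = inj₁ refl

  role-last : ∀ {c} → ¬ IsMiddle c → IsLast c → role c ≡ last ⊎ (role c ≡ inner × IsFirst c)
  role-last {c} ¬m l with middle? c | first? c | last? c
  ... | yes m | _     | _     = ⊥-elim (¬m m)
  ... | no _  | _     | no ¬l = ⊥-elim (¬l l)
  ... | no _  | yes f | yes _ = inj₂ (refl , f)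
  ... | no _  | no _  | yes _ = inj₁ refl

  homLM : ∀ {ω β′ γ′} → IsMiddle ω → Feasible P ω β′ γ′ → HomLM P
  homLM (_ , _ , t₁) t₂ = record { t₁ = t₁ ; t₂ = t₂ }

  homLM-inv : ∀ {ω β′ γ′} → IsMiddle ω → Feasible P γ′ β′ ω → HomLM (inv P)
  homLM-inv (_ , _ , t₁) t₂ = record { t₁ = t₁ ; t₂ = t₂ }

  hom3T : ∀ {ω β′ ω′} → IsLast ω → Feasible P ω β′ ω′ → IsFirst ω′ → Hom3T P
  hom3T (_ , _ , t₁) t₂ (_ , _ , t₃) = record { t₁ = t₁ ; t₂ = t₂ ; t₃ = t₃ }

  homLM? : Dec (HomLM P)
  homLM? = map′ (λ (_ , m , _ , _ , t) → homLM m t)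
                (λ h → let open HomLM h in ω , (α , γ , t₁) , (β′ , γ′ , t₂))
                (any? λ ω → middle? ω ×-dec first? ω)

  homLM-inv? : Dec (HomLM (inv P))
  homLM-inv? = map′ (λ (_ , m , _ , _ , t) → homLM-inv m t)
                    (λ h → let open HomLM h in ω , (γ , α , t₁) , (γ′ , β′ , t₂))
                    (any? λ ω → middle? ω ×-dec last? ω)

  hom3T? : Dec (Hom3T P)
  hom3T? = map′ (λ (_ , _ , _ , l , t , f) → hom3T l t f)
                (λ h → let open Hom3T h in ω , β′ , ω′ , (α , β , t₁) , t₂ , (β″ , γ″ , t₃))
                (any? λ ω → any? λ β′ → any? λ ω′ → last? ω ×-dec feasible? ω β′ ω′ ×-dec first? ω′)

  allowed : ¬ HomLM P → ¬ HomLM (inv P) → ¬ Hom3T P →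
    ∀ {x y z} → Feasible P x y z → Allowed (role x) (role y) (role z)
  allowed ¬lm ¬lm⁻¹ ¬3t {x} {y} {z} t
    with role-first (λ m → ¬lm (homLM m t)) (y , z , t)
       | role-last (λ m → ¬lm⁻¹ (homLM-inv m t)) (x , y , t)
       | role-middle (x , z , t)
  ... | inj₁ x-first       | inj₁ z-last        | y-middle rewrite x-first | y-middle | z-last  = first-last
  ... | inj₁ x-first       | inj₂ (z-inner , _) | y-middle rewrite x-first | y-middle | z-inner = first-inner
  ... | inj₂ (x-inner , _) | inj₁ z-last        | y-middle rewrite x-inner | y-middle | z-last  = inner-last
  ... | inj₂ (_ , x-last)  | inj₂ (_ , z-first) | _ = ⊥-elim (¬3t (hom3T x-last t z-first))

m+o≡n⇒m≤n : ∀ {m n} k → m + k ≡ n → m ≤ n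
m+o≡n⇒m≤n k refl = m≤m+n _ k

by-order : (R : ℕ → ℕ → Set) → (∀ m d → R m (m + d)) → (∀ n d → R (n + d) n) → ∀ m n → R m n
by-order R below above m n with ≤-total m n
... | inj₁ m≤n with m≤n⇒∃[o]m+o≡n m≤n
...   | d , refl = below m d
by-order R below above m n | inj₂ n≤m with m≤n⇒∃[o]m+o≡n n≤m
...   | d , refl = above n d

2*m*n≤m*m+n*n : ∀ m n → 2 * m * n ≤ m * m + n * n
2*m*n≤m*m+n*n = by-order (λ m n → 2 * m * n ≤ m * m + n * n)
  (λ m d → m+o≡n⇒m≤n (d * d) (solve (m ∷ d ∷ [])))
  (λ n d → m+o≡n⇒m≤n (d * d) (solve (n ∷ d ∷ [])))

3*[ab+ac+bc]≤[a+b+c]² : ∀ a b c → 3 * (a * b + a * c + b * c) ≤ (a + b + c) * (a + b + c)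
3*[ab+ac+bc]≤[a+b+c]² a b c = *-cancelˡ-≤ 2 (begin
  2 * (3 * (a * b + a * c + b * c))
    ≡⟨ solve (a ∷ b ∷ c ∷ []) ⟩
  2 * a * b + 2 * a * c + 2 * b * c + 4 * (a * b + a * c + b * c)
    ≤⟨ +-monoˡ-≤ (4 * (a * b + a * c + b * c))
         (+-mono-≤ (+-mono-≤ (2*m*n≤m*m+n*n a b) (2*m*n≤m*m+n*n a c)) (2*m*n≤m*m+n*n b c)) ⟩
  (a * a + b * b) + (a * a + c * c) + (b * b + c * c) + 4 * (a * b + a * c + b * c)
    ≡⟨ solve (a ∷ b ∷ c ∷ []) ⟩
  2 * ((a + b + c) * (a + b + c)) ∎)
  where open ≤-Reasoning

-- AM-GM for t, s, s: the difference of the two sides is 4 (t - s)² (t + 8 s).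
108*t*s²≤4*[t+2s]³ : ∀ t s → 108 * t * (s * s) ≤ 4 * ((t + 2 * s) * (t + 2 * s) * (t + 2 * s))
108*t*s²≤4*[t+2s]³ = by-order (λ t s → 108 * t * (s * s) ≤ 4 * ((t + 2 * s) * (t + 2 * s) * (t + 2 * s)))
  (λ t d → m+o≡n⇒m≤n (4 * (d * d) * (9 * t + 8 * d)) (solve (t ∷ d ∷ [])))
  (λ s d → m+o≡n⇒m≤n (4 * (d * d) * (9 * s + d)) (solve (s ∷ d ∷ [])))

27*m*s²≤4*[m+s]³ : ∀ m s → 27 * m * (s * s) ≤ 4 * ((m + s) * (m + s) * (m + s))
27*m*s²≤4*[m+s]³ m s = *-cancelˡ-≤ 8 (begin
  8 * (27 * m * (s * s))                                    ≡⟨ solve (m ∷ s ∷ []) ⟩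
  108 * (2 * m) * (s * s)                                   ≤⟨ 108*t*s²≤4*[t+2s]³ (2 * m) s ⟩
  4 * ((2 * m + 2 * s) * (2 * m + 2 * s) * (2 * m + 2 * s)) ≡⟨ solve (m ∷ s ∷ []) ⟩
  8 * (4 * ((m + s) * (m + s) * (m + s)))                   ∎)
  where open ≤-Reasoning

81*m*[ab+ac+bc]≤4*[m+a+b+c]³ : ∀ m a b c →
  81 * (m * (a * b + a * c + b * c)) ≤ 4 * ((m + (a + b + c)) * (m + (a + b + c)) * (m + (a + b + c)))
81*m*[ab+ac+bc]≤4*[m+a+b+c]³ m a b c = begin
  81 * (m * (a * b + a * c + b * c))     ≡⟨ solve (m ∷ a ∷ b ∷ c ∷ []) ⟩
  27 * m * (3 * (a * b + a * c + b * c)) ≤⟨ *-monoʳ-≤ (27 * m) (3*[ab+ac+bc]≤[a+b+c]² a b c) ⟩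
  27 * m * (s * s)                       ≤⟨ 27*m*s²≤4*[m+s]³ m s ⟩
  4 * ((m + s) * (m + s) * (m + s))      ∎
  where
  open ≤-Reasoning
  s : ℕ
  s = a + b + c

open Positions using (role; allowed; homLM?; homLM-inv?; hom3T?)

density≤4/81 : ∀ P → ¬ HomLM P → ¬ HomLM (inv P) → ¬ Hom3T P →
  81 * numTriples P ≤ 4 * (ncolors P * ncolors P * ncolors P)
density≤4/81 P ¬lm ¬lm⁻¹ ¬3t = begin
  81 * numTriples P
    ≤⟨ *-monoʳ-≤ 81 (numTriples≤ (allowed P ¬lm ¬lm⁻¹ ¬3t)) ⟩
  81 * (# middle * (a * b + a * c + b * c))
    ≤⟨ 81*m*[ab+ac+bc]≤4*[m+a+b+c]³ (# middle) a b c ⟩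
  4 * (N * N * N)
    ≤⟨ *-monoʳ-≤ 4 (*-mono-≤ (*-mono-≤ roles≤ncolors roles≤ncolors) roles≤ncolors) ⟩
  4 * (ncolors P * ncolors P * ncolors P) ∎
  where
  open ≤-Reasoning
  open Counting P (role P)
  a b c N : ℕ
  a = # first
  b = # inner
  c = # last
  N = # middle + (a + b + c)

lemma6p1 : (P : Palette) → DensityAbove4/81 P →
    (HomLM P ⊎ HomLM (inv P)) ⊎ Hom3T P
lemma6p1 P dense with homLM? P | homLM-inv? P | hom3T? P
... | yes lm | _      | _     = inj₁ (inj₁ lm)
... | no _   | yes lm | _     = inj₁ (inj₂ lm)
... | no _   | no _   | yes h = inj₂ h
... | no ¬lm | no ¬lm⁻¹ | no ¬3t = ⊥-elim (<⇒≱ dense (density≤4/81 P ¬lm ¬lm⁻¹ ¬3t))
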